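{- Let $\tilde e_1,\dots,\tilde e_n$ be the standard unit vectors of $\mathbb{R}^n$, $\tilde e_{n+1}=(-1,\dots,-1)$, and $S=\{ -\tilde e_1,\dots,-\tilde e_{n+1}\}$. Then the tropical unit ball $B^n$ is the (min) tropical convex hull of $S$, i.e. $$B^n=\Big\{\big(\min_{1\le k\le n+1}(a_k-(\tilde e_k)_i)\big)_{i=1}^n:\ a_1,\dots,a_{n+1}\ge 0,\ \min_k a_k=0\Big\}.$$
   Context: The tropical distance on $\mathbb{R}^n$ is $d_{\mathrm{tr}}(x,y)=\max\{\max_i(x_i-y_i),0\}-\min\{\min_i(x_i-y_i),0\}$ and $B^n=\{x: d_{\mathrm{tr}}(0,x)\le 1\}$. The (min) tropical convex hull of a finite set $\{v_1,\dots,v_r\}\subset\mathbb{R}^n$ is the set of min-plus combinations $a_1\odot v_1\oplus\dots\oplus a_r\odot v_r$, where $\oplus$ is coordinatewise minimum, $a\odot v=v+a(1,\dots,1)$, and the coefficients satisfy $a_k\ge0$, $\min_k a_k=0$ (this corresponds to tropical convex hulls in the tropical projective torus under the identification $(x_1:\dots:x_{n+1})\mapsto(x_1-x_{n+1},\dots,x_n-x_{n+1})$). -}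

module Defs where


open import Data.Nat using (ℕ; zero; suc)
open import Data.Nat as ℕ using ()
open import Data.Fin using (Fin; zero; suc; toℕ)
open import Data.Sum using (_⊎_; inj₁; inj₂)
open import Data.Product using (_×_; Σ; ∃; _,_)
open import Relation.Nullary using (¬_; yes; no)
open import Relation.Binary.PropositionalEquality using (_≡_)

-- A linearly ordered abelian group with a distinguished positive element 1#.
-- ℝ (with its usual order and 1) is an instance; the proposition is stated
-- for every such structure.
record LinOrdAbGroup : Set₁ where
  infixl 6 _+_ _-_
  infix  4 _≤_
  field
    Carrier  : Set
    _+_      : Carrier → Carrier → Carrier
    -_       : Carrier → Carrier
    0#       : Carrier
    1#       : Carrier
    _≤_      : Carrier → Carrier → Set
    +-assoc  : ∀ x y z → (x + y) + z ≡ x + (y + z)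
    +-comm   : ∀ x y → x + y ≡ y + x
    +-idʳ    : ∀ x → x + 0# ≡ x
    +-invʳ   : ∀ x → x + (- x) ≡ 0#
    ≤-refl   : ∀ x → x ≤ x
    ≤-trans  : ∀ {x y z} → x ≤ y → y ≤ z → x ≤ z
    ≤-antisym : ∀ {x y} → x ≤ y → y ≤ x → x ≡ y
    ≤-total  : ∀ x y → x ≤ y ⊎ y ≤ x
    +-monoˡ-≤ : ∀ {x y} z → x ≤ y → x + z ≤ y + z
    0≤1      : 0# ≤ 1#
    1≢0      : ¬ (1# ≡ 0#)

  _-_ : Carrier → Carrier → Carrier
  x - y = x + (- y)

  _⊓_ : Carrier → Carrier → Carrier
  x ⊓ y with ≤-total x y
  ... | inj₁ _ = x
  ... | inj₂ _ = y

  _⊔_ : Carrier → Carrier → Carrier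
  x ⊔ y with ≤-total x y
  ... | inj₁ _ = y
  ... | inj₂ _ = x

  Vecⁿ : ℕ → Set
  Vecⁿ n = Fin n → Carrier

  max0 : ∀ {n} → Vecⁿ n → Carrier
  max0 {zero}  z = 0#
  max0 {suc n} z = z zero ⊔ max0 (λ i → z (suc i))

  min0 : ∀ {n} → Vecⁿ n → Carrier
  min0 {zero}  z = 0#
  min0 {suc n} z = z zero ⊓ min0 (λ i → z (suc i))

  minFin : ∀ {m} → (Fin (suc m) → Carrier) → Carrier
  minFin {zero}  f = f zero
  minFin {suc m} f = f zero ⊓ minFin (λ k → f (suc k))

  dtr : ∀ {n} → Vecⁿ n → Vecⁿ n → Carrier
  dtr x y = max0 (λ i → x i - y i) - min0 (λ i → x i - y i)

  InBall : ∀ n → Vecⁿ n → Set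
  InBall n x = dtr (λ _ → 0#) x ≤ 1#

  InTconv : ∀ {n m} → (Fin (suc m) → Vecⁿ n) → Vecⁿ n → Set
  InTconv {n} {m} v x =
    Σ (Fin (suc m) → Carrier) λ a →
      ((k : Fin (suc m)) → 0# ≤ a k) ×
      (minFin a ≡ 0#) ×
      ((i : Fin n) → x i ≡ minFin (λ k → a k + v k i))

  -- ẽ_k for k = 1..n+1 (k indexed by Fin (suc n)); ẽ_{n+1} = (-1,…,-1)
  ẽ : ∀ n → Fin (suc n) → Vecⁿ n
  ẽ n k i with toℕ k ℕ.≟ n
  ... | yes _ = - 1#
  ... | no _ with toℕ k ℕ.≟ toℕ i
  ...   | yes _ = 1#
  ...   | no _  = 0#

  S : ∀ n → Fin (suc n) → Vecⁿ n
  S n k i = - ẽ n k i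

{-# OPTIONS --safe #-}
-- Write x̂ = (0, x) for the vector x ∈ ℝⁿ with its homogenising coordinate 0
-- put in front.  Then d_tr(0, x) = max x̂ − min x̂, so Bⁿ is the set of x
-- whose x̂ has spread at most 1.  The homogenised generators (0, −ẽ_k) take
-- only the two values lo and lo + 1 (lo = 0 for k = n+1 and lo = −1
-- otherwise), and spread at most c is preserved by min-plus combinations,
-- so the hull lies in the ball.  Conversely, for x in the ball the
-- coefficients a_k = x_k + 1 (k ≤ n), a_{n+1} = 0 are nonnegative, and
-- min_k (a_k − (ẽ_k)_i) is attained at k = i with value x_i.
module Submission where

open import Defs
open import Data.Nat using (ℕ)
open import Data.Product using (_×_; ∃; _,_)

open import Algebra.Bundles using (AbelianGroup)
open import Algebra.Consequences.Propositional using (comm∧idʳ⇒id; comm∧invʳ⇒inv)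
open import Algebra.Construct.NaturalChoice.Base using (MinOperator; MaxOperator)
import Algebra.Construct.NaturalChoice.MaxOp as MaxOp
import Algebra.Construct.NaturalChoice.MinOp as MinOp
import Algebra.Properties.AbelianGroup as AbelianGroupProperties
import Data.Nat as ℕ
open import Data.Fin using (Fin; zero; suc; toℕ; fromℕ; inject₁; _≟_)
open import Data.Fin.Properties using (toℕ-fromℕ; toℕ-inject₁; toℕ-inject₁-≢; toℕ-injective)
open import Data.Fin.Relation.Unary.Top using (view; view-fromℕ; view-inject₁; ‵fromℕ; ‵inject₁)
open import Data.Sum using (_⊎_; inj₁; inj₂)
open import Data.Vec.Functional using (_∷_)
open import Function using (_∘_; _⇔_; mk⇔; Equivalence)
open import Level using (0ℓ)
open import Relation.Binary.Bundles using (TotalOrder)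
import Relation.Binary.Reasoning.PartialOrder as ≤-Reasoning
open import Relation.Binary.PropositionalEquality using (_≡_; _≢_; _≗_; refl; sym; trans; cong; cong₂; subst; subst₂; isEquivalence)
open import Relation.Nullary using (yes; no; contradiction)

open Equivalence using (to; from)

module TropicalBall (G : LinOrdAbGroup) where
  open LinOrdAbGroup G

  ≤-totalOrder : TotalOrder 0ℓ 0ℓ 0ℓ
  ≤-totalOrder = record
    { isTotalOrder = record
      { isPartialOrder = record
        { isPreorder = record
          { isEquivalence = isEquivalence
          ; reflexive     = λ { refl → ≤-refl _ }
          ; trans         = ≤-trans
          }
        ; antisym = ≤-antisym
        }
      ; total = ≤-total
      }
    }

  open TotalOrder ≤-totalOrder using (poset; totalPreorder; reflexive)

  ⊓-operator : MinOperator totalPreorder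
  ⊓-operator = record { x≤y⇒x⊓y≈x = x≤y⇒x⊓y≡x ; x≥y⇒x⊓y≈y = x≥y⇒x⊓y≡y }
    where
    x≤y⇒x⊓y≡x : ∀ {x y} → x ≤ y → x ⊓ y ≡ x
    x≤y⇒x⊓y≡x {x} {y} x≤y with ≤-total x y
    ... | inj₁ _   = refl
    ... | inj₂ y≤x = ≤-antisym y≤x x≤y

    x≥y⇒x⊓y≡y : ∀ {x y} → y ≤ x → x ⊓ y ≡ y
    x≥y⇒x⊓y≡y {x} {y} y≤x with ≤-total x y
    ... | inj₁ x≤y = ≤-antisym x≤y y≤x
    ... | inj₂ _   = refl

  ⊔-operator : MaxOperator totalPreorder
  ⊔-operator = record { x≤y⇒x⊔y≈y = x≤y⇒x⊔y≡y ; x≥y⇒x⊔y≈x = x≥y⇒x⊔y≡x }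
    where
    x≤y⇒x⊔y≡y : ∀ {x y} → x ≤ y → x ⊔ y ≡ y
    x≤y⇒x⊔y≡y {x} {y} x≤y with ≤-total x y
    ... | inj₁ _   = refl
    ... | inj₂ y≤x = ≤-antisym x≤y y≤x

    x≥y⇒x⊔y≡x : ∀ {x y} → y ≤ x → x ⊔ y ≡ x
    x≥y⇒x⊔y≡x {x} {y} y≤x with ≤-total x y
    ... | inj₁ x≤y = ≤-antisym y≤x x≤y
    ... | inj₂ _   = refl

  open MinOp ⊓-operator using (x⊓y≤x; x⊓y≤y; ⊓-glb; ⊓-sel)
  open MaxOp ⊔-operator using (x≤x⊔y; x≤y⊔x; ⊔-sel)

  +-abelianGroup : AbelianGroup 0ℓ 0ℓ
  +-abelianGroup = record
    { _∙_ = _+_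
    ; ε   = 0#
    ; _⁻¹ = -_
    ; isAbelianGroup = record
      { isGroup = record
        { isMonoid = record
          { isSemigroup = record
            { isMagma = record { isEquivalence = isEquivalence ; ∙-cong = cong₂ _+_ }
            ; assoc   = +-assoc
            }
          ; identity = comm∧idʳ⇒id +-comm +-idʳ
          }
        ; inverse = comm∧invʳ⇒inv +-comm +-invʳ
        ; ⁻¹-cong = cong (λ x → - x)
        }
      ; comm = +-comm
      }
    }

  open AbelianGroup +-abelianGroup using (identityˡ; inverseˡ)
  open AbelianGroupProperties +-abelianGroup using (ε⁻¹≈ε; ⁻¹-involutive; xyx⁻¹≈y; //-rightDividesˡ; //-rightDividesʳ)

  +-monoʳ-≤ : ∀ x {y z} → y ≤ z → x + y ≤ x + z
  +-monoʳ-≤ x {y} {z} y≤z = subst₂ _≤_ (+-comm y x) (+-comm z x) (+-monoˡ-≤ x y≤z)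

  -≤⇔≤+ : ∀ {x y z} → x - y ≤ z ⇔ x ≤ y + z
  -≤⇔≤+ {x} {y} {z} = mk⇔
    (λ x-y≤z → subst₂ _≤_ (//-rightDividesˡ y x) (+-comm z y) (+-monoˡ-≤ y x-y≤z))
    (λ x≤y+z → subst (x - y ≤_) (xyx⁻¹≈y y z) (+-monoˡ-≤ (- y) x≤y+z))

  neg-≤⇔ : ∀ {x y c} → - x ≤ - y + c ⇔ y ≤ x + c
  neg-≤⇔ {x} {y} {c} = mk⇔
    (λ h → to -≤⇔≤+ (subst (_≤ c) -x--y≡y-x (from -≤⇔≤+ h)))
    (λ h → to -≤⇔≤+ (subst (_≤ c) (sym -x--y≡y-x) (from -≤⇔≤+ h)))
    where
    -x--y≡y-x : - x - - y ≡ y - x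
    -x--y≡y-x = trans (+-comm (- x) (- (- y))) (cong (_- x) (⁻¹-involutive y))

  minFin-≤ : ∀ {m} (f : Fin (ℕ.suc m) → Carrier) k → minFin f ≤ f k
  minFin-≤ {ℕ.zero}  f zero    = ≤-refl (f zero)
  minFin-≤ {ℕ.suc m} f zero    = x⊓y≤x _ _
  minFin-≤ {ℕ.suc m} f (suc k) = ≤-trans (x⊓y≤y _ _) (minFin-≤ (f ∘ suc) k)

  ≤-minFin : ∀ {m y} (f : Fin (ℕ.suc m) → Carrier) → (∀ k → y ≤ f k) → y ≤ minFin f
  ≤-minFin {ℕ.zero}  f y≤f = y≤f zero
  ≤-minFin {ℕ.suc m} f y≤f = ⊓-glb (y≤f zero) (≤-minFin (f ∘ suc) (y≤f ∘ suc))

  minFin-attained : ∀ {m} (f : Fin (ℕ.suc m) → Carrier) → ∃ λ k → minFin f ≡ f k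
  minFin-attained {ℕ.zero}  f = zero , refl
  minFin-attained {ℕ.suc m} f with ⊓-sel (f zero) (minFin (f ∘ suc)) | minFin-attained (f ∘ suc)
  ... | inj₁ min≡f0 | _          = zero , min≡f0
  ... | inj₂ min≡m  | k , m≡fsk = suc k , trans min≡m m≡fsk

  lowerBound∧attained⇒minFin≡ : ∀ {m y} (f : Fin (ℕ.suc m) → Carrier) k →
    (∀ k → y ≤ f k) → f k ≡ y → minFin f ≡ y
  lowerBound∧attained⇒minFin≡ f k y≤f fk≡y =
    ≤-antisym (subst (minFin f ≤_) fk≡y (minFin-≤ f k)) (≤-minFin f y≤f)

  minFin-cong : ∀ {m} {f g : Fin (ℕ.suc m) → Carrier} → f ≗ g → minFin f ≡ minFin g
  minFin-cong {ℕ.zero}  f≗g = f≗g zero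
  minFin-cong {ℕ.suc m} f≗g = cong₂ _⊓_ (f≗g zero) (minFin-cong (f≗g ∘ suc))

  _∷ʳ_ : ∀ {n} → Vecⁿ n → Carrier → Vecⁿ (ℕ.suc n)
  (v ∷ʳ c) k with view k
  ... | ‵fromℕ     = c
  ... | ‵inject₁ j = v j

  ∷ʳ-fromℕ : ∀ {n} (v : Vecⁿ n) c → (v ∷ʳ c) (fromℕ n) ≡ c
  ∷ʳ-fromℕ {n} v c rewrite view-fromℕ n = refl

  ∷ʳ-inject₁ : ∀ {n} (v : Vecⁿ n) c j → (v ∷ʳ c) (inject₁ j) ≡ v j
  ∷ʳ-inject₁ v c j rewrite view-inject₁ j = refl

  ≤-max0 : ∀ {n} (z : Vecⁿ n) p → (0# ∷ z) p ≤ max0 z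
  ≤-max0 {ℕ.zero}  z zero          = ≤-refl 0#
  ≤-max0 {ℕ.suc n} z zero          = ≤-trans (≤-max0 (z ∘ suc) zero) (x≤y⊔x _ _)
  ≤-max0 {ℕ.suc n} z (suc zero)    = x≤x⊔y _ _
  ≤-max0 {ℕ.suc n} z (suc (suc i)) = ≤-trans (≤-max0 (z ∘ suc) (suc i)) (x≤y⊔x _ _)

  min0-≤ : ∀ {n} (z : Vecⁿ n) p → min0 z ≤ (0# ∷ z) p
  min0-≤ {ℕ.zero}  z zero          = ≤-refl 0#
  min0-≤ {ℕ.suc n} z zero          = ≤-trans (x⊓y≤y _ _) (min0-≤ (z ∘ suc) zero)
  min0-≤ {ℕ.suc n} z (suc zero)    = x⊓y≤x _ _
  min0-≤ {ℕ.suc n} z (suc (suc i)) = ≤-trans (x⊓y≤y _ _) (min0-≤ (z ∘ suc) (suc i))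

  max0-attained : ∀ {n} (z : Vecⁿ n) → ∃ λ p → max0 z ≡ (0# ∷ z) p
  max0-attained {ℕ.zero}  z = zero , refl
  max0-attained {ℕ.suc n} z with ⊔-sel (z zero) (max0 (z ∘ suc)) | max0-attained (z ∘ suc)
  ... | inj₁ max≡z0 | _              = suc zero , max≡z0
  ... | inj₂ max≡m  | zero , m≡0     = zero , trans max≡m m≡0
  ... | inj₂ max≡m  | suc i , m≡zsi = suc (suc i) , trans max≡m m≡zsi

  min0-attained : ∀ {n} (z : Vecⁿ n) → ∃ λ p → min0 z ≡ (0# ∷ z) p
  min0-attained {ℕ.zero}  z = zero , refl
  min0-attained {ℕ.suc n} z with ⊓-sel (z zero) (min0 (z ∘ suc)) | min0-attained (z ∘ suc)
  ... | inj₁ min≡z0 | _              = suc zero , min≡z0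
  ... | inj₂ min≡m  | zero , m≡0     = zero , trans min≡m m≡0
  ... | inj₂ min≡m  | suc i , m≡zsi = suc (suc i) , trans min≡m m≡zsi

  SpreadAtMost : ∀ {m} → Carrier → Vecⁿ m → Set
  SpreadAtMost c f = ∀ p q → f p ≤ f q + c

  spreadAtMost-resp-≗ : ∀ {m c} {f g : Vecⁿ m} → f ≗ g → SpreadAtMost c f → SpreadAtMost c g
  spreadAtMost-resp-≗ {c = c} f≗g spread p q =
    subst₂ (λ u v → u ≤ v + c) (f≗g p) (f≗g q) (spread p q)

  spreadAtMost-neg⇔ : ∀ {m c} {f : Vecⁿ m} → SpreadAtMost c (λ p → - f p) ⇔ SpreadAtMost c f
  spreadAtMost-neg⇔ = mk⇔ (λ spread p q → to neg-≤⇔ (spread q p))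
                           (λ spread p q → from neg-≤⇔ (spread q p))

  twoValued⇒spreadAtMost : ∀ {m c} lo (f : Vecⁿ m) → 0# ≤ c →
    (∀ p → f p ≡ lo ⊎ f p ≡ lo + c) → SpreadAtMost c f
  twoValued⇒spreadAtMost {c = c} lo f 0≤c f∈ p q =
    ≤-trans (below-top (f∈ p)) (+-monoˡ-≤ c (above-bottom (f∈ q)))
    where
    lo≤lo+c : lo ≤ lo + c
    lo≤lo+c = subst (_≤ lo + c) (+-idʳ lo) (+-monoʳ-≤ lo 0≤c)

    below-top : ∀ {u} → u ≡ lo ⊎ u ≡ lo + c → u ≤ lo + c
    below-top (inj₁ refl) = lo≤lo+c
    below-top (inj₂ refl) = ≤-refl _

    above-bottom : ∀ {u} → u ≡ lo ⊎ u ≡ lo + c → lo ≤ u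
    above-bottom (inj₁ refl) = ≤-refl _
    above-bottom (inj₂ refl) = lo≤lo+c

  spreadAtMost-minPlus : ∀ {m n c} (a : Fin (ℕ.suc m) → Carrier) (v : Fin (ℕ.suc m) → Vecⁿ n) →
    (∀ k → SpreadAtMost c (v k)) → SpreadAtMost c (λ p → minFin (λ k → a k + v k p))
  spreadAtMost-minPlus {c = c} a v spread p q with minFin-attained (λ k → a k + v k q)
  ... | k , min≡ = begin
    minFin (λ k → a k + v k p)     ≤⟨ minFin-≤ (λ k → a k + v k p) k ⟩
    a k + v k p                    ≤⟨ +-monoʳ-≤ (a k) (spread k p q) ⟩
    a k + (v k q + c)              ≡⟨ +-assoc (a k) (v k q) c ⟨
    a k + v k q + c                ≡⟨ cong (_+ c) min≡ ⟨
    minFin (λ k → a k + v k q) + c ∎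
    where open ≤-Reasoning poset

  max0-min0⇔spreadAtMost : ∀ {n c} (z : Vecⁿ n) → max0 z - min0 z ≤ c ⇔ SpreadAtMost c (0# ∷ z)
  max0-min0⇔spreadAtMost {c = c} z = mk⇔ bounded⇒spread spread⇒bounded
    where
    bounded⇒spread : max0 z - min0 z ≤ c → SpreadAtMost c (0# ∷ z)
    bounded⇒spread max-min≤c p q = begin
      (0# ∷ z) p     ≤⟨ ≤-max0 z p ⟩
      max0 z         ≤⟨ to -≤⇔≤+ max-min≤c ⟩
      min0 z + c     ≤⟨ +-monoˡ-≤ c (min0-≤ z q) ⟩
      (0# ∷ z) q + c ∎
      where open ≤-Reasoning poset

    spread⇒bounded : SpreadAtMost c (0# ∷ z) → max0 z - min0 z ≤ c
    spread⇒bounded spread with max0-attained z | min0-attained z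
    ... | p , max≡ | q , min≡ =
      from -≤⇔≤+ (subst₂ (λ u v → u ≤ v + c) (sym max≡) (sym min≡) (spread p q))

  inBall⇔spreadAtMost : ∀ {n} (x : Vecⁿ n) → InBall n x ⇔ SpreadAtMost 1# (0# ∷ x)
  inBall⇔spreadAtMost x = mk⇔
    (λ x∈B → to spreadAtMost-neg⇔
               (spreadAtMost-resp-≗ 0∷-x≗-0∷x (to (max0-min0⇔spreadAtMost _) x∈B)))
    (λ spread → from (max0-min0⇔spreadAtMost _)
                  (spreadAtMost-resp-≗ (sym ∘ 0∷-x≗-0∷x) (from spreadAtMost-neg⇔ spread)))
    where
    0∷-x≗-0∷x : (0# ∷ (λ i → 0# - x i)) ≗ (λ p → - (0# ∷ x) p)
    0∷-x≗-0∷x zero    = sym ε⁻¹≈ε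
    0∷-x≗-0∷x (suc i) = identityˡ (- x i)

  S-fromℕ : ∀ {n} (i : Fin n) → S n (fromℕ n) i ≡ 1#
  S-fromℕ {n} i with toℕ (fromℕ n) ℕ.≟ n
  ... | yes _      = ⁻¹-involutive 1#
  ... | no last≢n = contradiction (toℕ-fromℕ n) last≢n

  S-inject₁-self : ∀ {n} (i : Fin n) → S n (inject₁ i) i ≡ - 1#
  S-inject₁-self {n} i with toℕ (inject₁ i) ℕ.≟ n
  ... | yes i≡n = contradiction (sym i≡n) (toℕ-inject₁-≢ i)
  ... | no _ with toℕ (inject₁ i) ℕ.≟ toℕ i
  ...   | yes _   = refl
  ...   | no i≢i = contradiction (toℕ-inject₁ i) i≢i

  S-inject₁-other : ∀ {n} {j i : Fin n} → j ≢ i → S n (inject₁ j) i ≡ 0#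
  S-inject₁-other {n} {j} {i} j≢i with toℕ (inject₁ j) ℕ.≟ n
  ... | yes j≡n = contradiction (sym j≡n) (toℕ-inject₁-≢ j)
  ... | no _ with toℕ (inject₁ j) ℕ.≟ toℕ i
  ...   | yes j≡i = contradiction (toℕ-injective (trans (sym (toℕ-inject₁ j)) j≡i)) j≢i
  ...   | no _    = ε⁻¹≈ε

  0∷S-spreadAtMost : ∀ {n} k → SpreadAtMost 1# (0# ∷ S n k)
  0∷S-spreadAtMost {n} k with view k
  ... | ‵fromℕ     = twoValued⇒spreadAtMost 0# _ 0≤1 values
    where
    values : ∀ p → (0# ∷ S n (fromℕ n)) p ≡ 0# ⊎ (0# ∷ S n (fromℕ n)) p ≡ 0# + 1#
    values zero    = inj₁ refl
    values (suc i) = inj₂ (trans (S-fromℕ i) (sym (identityˡ 1#)))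
  ... | ‵inject₁ j = twoValued⇒spreadAtMost (- 1#) _ 0≤1 values
    where
    values : ∀ p → (0# ∷ S n (inject₁ j)) p ≡ - 1# ⊎ (0# ∷ S n (inject₁ j)) p ≡ - 1# + 1#
    values zero = inj₂ (sym (inverseˡ 1#))
    values (suc i) with j ≟ i
    ... | yes refl = inj₁ (S-inject₁-self i)
    ... | no j≢i   = inj₂ (trans (S-inject₁-other j≢i) (sym (inverseˡ 1#)))

  -- Nonnegativity of the coefficients is not needed for this inclusion.
  inTconv⇒spreadAtMost : ∀ {n} (x : Vecⁿ n) → InTconv (S n) x → SpreadAtMost 1# (0# ∷ x)
  inTconv⇒spreadAtMost {n} x (a , _ , min-a≡0 , x≡minPlus) =
    spreadAtMost-resp-≗ minPlus≗0∷x (spreadAtMost-minPlus a (λ k → 0# ∷ S n k) 0∷S-spreadAtMost)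
    where
    minPlus≗0∷x : (λ p → minFin (λ k → a k + (0# ∷ S n k) p)) ≗ (0# ∷ x)
    minPlus≗0∷x zero    = trans (minFin-cong (+-idʳ ∘ a)) min-a≡0
    minPlus≗0∷x (suc i) = sym (x≡minPlus i)

  spreadAtMost⇒inTconv : ∀ {n} (x : Vecⁿ n) → SpreadAtMost 1# (0# ∷ x) → InTconv (S n) x
  spreadAtMost⇒inTconv {n} x spread =
    a , a≥0 , lowerBound∧attained⇒minFin≡ a (fromℕ n) a≥0 (∷ʳ-fromℕ (λ j → x j + 1#) 0#) ,
    λ i → sym (lowerBound∧attained⇒minFin≡ (λ k → a k + S n k i) (inject₁ i) (x≤a+S i) (attained i))
    where
    a : Fin (ℕ.suc n) → Carrier
    a = (λ j → x j + 1#) ∷ʳ 0#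

    a≥0 : ∀ k → 0# ≤ a k
    a≥0 k with view k
    ... | ‵fromℕ     = ≤-refl 0#
    ... | ‵inject₁ j = spread zero (suc j)

    x+1+S≡x : ∀ i → x i + 1# + S n (inject₁ i) i ≡ x i
    x+1+S≡x i = trans (cong (x i + 1# +_) (S-inject₁-self i)) (//-rightDividesʳ 1# (x i))

    x≤a+S : ∀ i k → x i ≤ a k + S n k i
    x≤a+S i k with view k
    ... | ‵fromℕ = subst (x i ≤_) (cong (0# +_) (sym (S-fromℕ i))) (spread (suc i) zero)
    ... | ‵inject₁ j with j ≟ i
    ...   | yes refl = reflexive (sym (x+1+S≡x i))
    ...   | no j≢i   = subst (x i ≤_) (sym (trans (cong (x j + 1# +_) (S-inject₁-other j≢i)) (+-idʳ _)))
                             (spread (suc i) (suc j))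

    attained : ∀ i → a (inject₁ i) + S n (inject₁ i) i ≡ x i
    attained i = trans (cong (_+ S n (inject₁ i) i) (∷ʳ-inject₁ _ _ i)) (x+1+S≡x i)

open LinOrdAbGroup

proposition5p14 : (G : LinOrdAbGroup) (n : ℕ) (x : Vecⁿ G n) →
    (InBall G n x → InTconv G (S G n) x) × (InTconv G (S G n) x → InBall G n x)
proposition5p14 G n x =
  spreadAtMost⇒inTconv x ∘ to (inBall⇔spreadAtMost x) ,
  from (inBall⇔spreadAtMost x) ∘ inTconv⇒spreadAtMost x
  where open TropicalBall G
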